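{- Let $A$ be an srl-monoid and $H$ a convex subalgebra of $A$. Then $\theta_H=\{(a,b)\in A\times A: a\cdot h\leq b \text{ and } b\cdot h\leq a \text{ for some } h\in H\}$ is a congruence of $A$.
   Context: A commutative l-monoid is an algebra $(A,\wedge,\vee,\cdot,e)$ of type $(2,2,2,0)$ such that $(A,\wedge,\vee)$ is a lattice, $(A,\cdot,e)$ is a commutative monoid and $(a\vee b)\cdot c=(a\cdot c)\vee(b\cdot c)$ for all $a,b,c\in A$. An algebra $(A,\wedge,\vee,\cdot,\rightarrow,e)$ of type $(2,2,2,2,0)$ is an srl-monoid if $(A,\wedge,\vee,\cdot,e)$ is a commutative l-monoid and there is a subalgebra $Q$ of $(A,\wedge,\vee,\cdot,e)$ such that for all $a,b\in A$ the set $\{q\in Q: a\cdot q\leq b\}$ has a maximum and $a\rightarrow b$ equals this maximum. A convex subalgebra of $A$ is a subalgebra $H$ of $(A,\wedge,\vee,\cdot,\rightarrow,e)$ such that whenever $a,b\in H$, $c\in A$ and $a\le c\le b$, then $c\in H$. Congruences are of the algebra $(A,\wedge,\vee,\cdot,\rightarrow,e)$. -}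

module Defs where

open import Level using (Level; suc; _⊔_)
open import Data.Product using (Σ; _×_; ∃)
open import Relation.Binary.PropositionalEquality using (_≡_)
open import Relation.Binary.Structures using (IsEquivalence)
open import Algebra.Core using (Op₂)
open import Algebra.Structures using (IsCommutativeMonoid)
open import Algebra.Lattice.Structures using (IsLattice)

record IsCommLMonoid {c : Level} {A : Set c}
         (_∧_ _∨_ _·_ : Op₂ A) (e : A) : Set c where
  field
    isLattice           : IsLattice _≡_ _∨_ _∧_
    isCommutativeMonoid : IsCommutativeMonoid _≡_ _·_ e
    ·-distribʳ-∨        : ∀ a b c → ((a ∨ b) · c) ≡ ((a · c) ∨ (b · c))

_≤[_]_ : {c : Level} {A : Set c} → A → Op₂ A → A → Set c
a ≤[ _∨_ ] b = (a ∨ b) ≡ b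

record SrlMonoid (c : Level) : Set (suc c) where
  field
    Carrier : Set c
    _∧_ _∨_ _·_ _⇒_ : Op₂ Carrier
    e : Carrier
    isCommLMonoid : IsCommLMonoid _∧_ _∨_ _·_ e
    Q     : Carrier → Set c
    Q-∧   : ∀ {a b} → Q a → Q b → Q (a ∧ b)
    Q-∨   : ∀ {a b} → Q a → Q b → Q (a ∨ b)
    Q-·   : ∀ {a b} → Q a → Q b → Q (a · b)
    Q-e   : Q e
    ⇒-in-Q  : ∀ a b → Q (a ⇒ b)
    ⇒-resid : ∀ a b → (a · (a ⇒ b)) ≤[ _∨_ ] b
    ⇒-max   : ∀ a b q → Q q → (a · q) ≤[ _∨_ ] b → q ≤[ _∨_ ] (a ⇒ b)

module _ {c : Level} (A : SrlMonoid c) where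
  open SrlMonoid A

  _≤_ : Carrier → Carrier → Set c
  a ≤ b = a ≤[ _∨_ ] b

  record IsConvexSubalgebra {h : Level} (H : Carrier → Set h) : Set (c ⊔ h) where
    field
      H-∧ : ∀ {a b} → H a → H b → H (a ∧ b)
      H-∨ : ∀ {a b} → H a → H b → H (a ∨ b)
      H-· : ∀ {a b} → H a → H b → H (a · b)
      H-⇒ : ∀ {a b} → H a → H b → H (a ⇒ b)
      H-e : H e
      convex : ∀ {a b x} → H a → H b → a ≤ x → x ≤ b → H x

  θ : {h : Level} → (Carrier → Set h) → Carrier → Carrier → Set (c ⊔ h)
  θ H a b = Σ Carrier (λ k → H k × ((a · k) ≤ b) × ((b · k) ≤ a))

  -- congruence of (A, ∧, ∨, ·, ⇒, e): equivalence relation compatible with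
  -- all operations (compatibility with the constant e is automatic).
  record IsCongruence {ℓ : Level} (R : Carrier → Carrier → Set ℓ) : Set (c ⊔ ℓ) where
    field
      isEquivalence : IsEquivalence R
      ∧-compat : ∀ {a b a' b'} → R a a' → R b b' → R (a ∧ b) (a' ∧ b')
      ∨-compat : ∀ {a b a' b'} → R a a' → R b b' → R (a ∨ b) (a' ∨ b')
      ·-compat : ∀ {a b a' b'} → R a a' → R b b' → R (a · b) (a' · b')
      ⇒-compat : ∀ {a b a' b'} → R a a' → R b b' → R (a ⇒ b) (a' ⇒ b')

{-# OPTIONS --safe #-}
-- Any smaller element of H still witnesses (a, b) ∈ θ_H, so two witnesses k and l can be
-- replaced by the single witness e ⇒ (k ∧ l), which moreover lies in Q. Given a common
-- witness k, compatibility with ∧, ∨ and · follows from monotonicity and distributivity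
-- of ·, and compatibility with ⇒ from residuation, with witness k · k; transitivity
-- multiplies witnesses.
module Submission where

open import Level using (Level)
open import Function using (id)
open import Data.Product using (Σ; _×_; _,_; swap)
open import Relation.Binary.PropositionalEquality
  using (_≡_; sym; trans; cong; subst₂; isEquivalence; module ≡-Reasoning)
open import Relation.Binary.Core using (_Preserves₂_⟶_⟶_)
open import Relation.Binary.Structures using (IsEquivalence; IsPartialOrder)
import Relation.Binary.Lattice as Ord
import Relation.Binary.Reasoning.PartialOrder as ≤-Reasoning
open import Algebra.Core using (Op₂)
open import Algebra.Bundles using (CommutativeMonoid)
open import Algebra.Lattice.Bundles using (Lattice)
open import Algebra.Lattice.Structures using (IsLattice)
import Algebra.Lattice.Properties.Lattice as LatticeProperties
import Algebra.Properties.CommutativeSemigroup as CommutativeSemigroupProperties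
open import Defs hiding (_≤_)

module JoinOrder {c : Level} {A : Set c} {_∧_ _∨_ : Op₂ A}
                 (isLattice : IsLattice _≡_ _∨_ _∧_) where

  private
    open IsLattice isLattice using (∨-comm; ∧-comm; ∨-absorbs-∧; ∧-absorbs-∨)

    lattice : Lattice c c
    lattice = record { isLattice = isLattice }

    open LatticeProperties lattice using (∨-∧-orderTheoreticLattice)
    module M = Ord.Lattice ∨-∧-orderTheoreticLattice

  _≤_ : A → A → Set c
  x ≤ y = x ≤[ _∨_ ] y

  private
    ≤ₘ⇒≤ : ∀ {x y} → x M.≤ y → x ≤ y
    ≤ₘ⇒≤ {x} {y} x≡x∧y = begin
      x ∨ y        ≡⟨ cong (_∨ y) x≡x∧y ⟩
      (x ∧ y) ∨ y  ≡⟨ ∨-comm (x ∧ y) y ⟩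
      y ∨ (x ∧ y)  ≡⟨ cong (y ∨_) (∧-comm x y) ⟩
      y ∨ (y ∧ x)  ≡⟨ ∨-absorbs-∧ y x ⟩
      y            ∎
      where open ≡-Reasoning

    ≤⇒≤ₘ : ∀ {x y} → x ≤ y → x M.≤ y
    ≤⇒≤ₘ {x} {y} x∨y≡y = trans (sym (∧-absorbs-∨ x y)) (cong (x ∧_) x∨y≡y)

    ≤-isPartialOrder : IsPartialOrder _≡_ _≤_
    ≤-isPartialOrder = record
      { isPreorder = record
        { isEquivalence = isEquivalence
        ; reflexive     = λ x≡y → ≤ₘ⇒≤ (M.reflexive x≡y)
        ; trans         = λ x≤y y≤z → ≤ₘ⇒≤ (M.trans (≤⇒≤ₘ x≤y) (≤⇒≤ₘ y≤z))
        }
      ; antisym = λ x≤y y≤x → M.antisym (≤⇒≤ₘ x≤y) (≤⇒≤ₘ y≤x)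
      }

  -- The library orders a lattice by x ≡ x ∧ y; this is the same lattice for x ∨ y ≡ y.
  orderTheoreticLattice : Ord.Lattice c c c
  orderTheoreticLattice = record
    { isLattice = record
      { isPartialOrder = ≤-isPartialOrder
      ; supremum       = λ x y → ≤ₘ⇒≤ (M.x≤x∨y x y) , ≤ₘ⇒≤ (M.y≤x∨y x y)
                               , λ z x≤z y≤z → ≤ₘ⇒≤ (M.∨-least (≤⇒≤ₘ x≤z) (≤⇒≤ₘ y≤z))
      ; infimum        = λ x y → ≤ₘ⇒≤ (M.x∧y≤x x y) , ≤ₘ⇒≤ (M.x∧y≤y x y)
                               , λ z z≤x z≤y → ≤ₘ⇒≤ (M.∧-greatest (≤⇒≤ₘ z≤x) (≤⇒≤ₘ z≤y))
      }
    }

  open Ord.Lattice orderTheoreticLattice public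
    using (poset; reflexive; x≤x∨y; y≤x∨y; ∨-least; x∧y≤x; x∧y≤y; ∧-greatest)
    renaming (trans to ≤-trans)

module CommLMonoidProperties {c : Level} {A : Set c} {_∧_ _∨_ _·_ : Op₂ A} {e : A}
                             (isCommLMonoid : IsCommLMonoid _∧_ _∨_ _·_ e) where

  open IsCommLMonoid isCommLMonoid
  open JoinOrder isLattice public
  open ≤-Reasoning poset

  private
    commutativeMonoid : CommutativeMonoid c c
    commutativeMonoid = record { isCommutativeMonoid = isCommutativeMonoid }

  open CommutativeMonoid commutativeMonoid public
    using (assoc; comm; identityˡ; identityʳ)
  open CommutativeSemigroupProperties
    (CommutativeMonoid.commutativeSemigroup commutativeMonoid) public
    using (interchange)

  ·-monoˡ-≤ : ∀ {x y} k → x ≤ y → (x · k) ≤ (y · k)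
  ·-monoˡ-≤ {x} {y} k x∨y≡y = trans (sym (·-distribʳ-∨ x y k)) (cong (_· k) x∨y≡y)

  ·-monoʳ-≤ : ∀ k {x y} → x ≤ y → (k · x) ≤ (k · y)
  ·-monoʳ-≤ k {x} {y} x≤y = subst₂ _≤_ (comm x k) (comm y k) (·-monoˡ-≤ k x≤y)

  ·-mono-≤ : ∀ {x x' y y'} → x ≤ x' → y ≤ y' → (x · y) ≤ (x' · y')
  ·-mono-≤ {x} {x'} {y} x≤x' y≤y' = ≤-trans (·-monoˡ-≤ y x≤x') (·-monoʳ-≤ x' y≤y')

  ∧-compat-≤ : ∀ {a a' b b' k} → (a · k) ≤ a' → (b · k) ≤ b' → ((a ∧ b) · k) ≤ (a' ∧ b')
  ∧-compat-≤ {a} {a'} {b} {b'} {k} ak≤a' bk≤b' = ∧-greatest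
    (begin (a ∧ b) · k ≤⟨ ·-monoˡ-≤ k (x∧y≤x a b) ⟩ a · k ≤⟨ ak≤a' ⟩ a' ∎)
    (begin (a ∧ b) · k ≤⟨ ·-monoˡ-≤ k (x∧y≤y a b) ⟩ b · k ≤⟨ bk≤b' ⟩ b' ∎)

  ∨-compat-≤ : ∀ {a a' b b' k} → (a · k) ≤ a' → (b · k) ≤ b' → ((a ∨ b) · k) ≤ (a' ∨ b')
  ∨-compat-≤ {a} {a'} {b} {b'} {k} ak≤a' bk≤b' = begin
    (a ∨ b) · k          ≡⟨ ·-distribʳ-∨ a b k ⟩
    (a · k) ∨ (b · k)    ≤⟨ ∨-least (≤-trans ak≤a' (x≤x∨y a' b')) (≤-trans bk≤b' (y≤x∨y a' b')) ⟩
    a' ∨ b'              ∎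

  ·-compat-≤ : ∀ {a a' b b' k l} → (a · k) ≤ a' → (b · l) ≤ b' → ((a · b) · (k · l)) ≤ (a' · b')
  ·-compat-≤ {a} {a'} {b} {b'} {k} {l} ak≤a' bl≤b' = begin
    (a · b) · (k · l)    ≡⟨ interchange a b k l ⟩
    (a · k) · (b · l)    ≤⟨ ·-mono-≤ ak≤a' bl≤b' ⟩
    a' · b'              ∎

  ·-≤-chain : ∀ {a b d k l} → (a · k) ≤ b → (b · l) ≤ d → (a · (k · l)) ≤ d
  ·-≤-chain {a} {b} {d} {k} {l} ak≤b bl≤d = begin
    a · (k · l)    ≡⟨ sym (assoc a k l) ⟩
    (a · k) · l    ≤⟨ ·-monoˡ-≤ l ak≤b ⟩
    b · l          ≤⟨ bl≤d ⟩
    d              ∎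

module SrlMonoidProperties {c : Level} (A : SrlMonoid c) where

  open SrlMonoid A
  open CommLMonoidProperties isCommLMonoid public
  open ≤-Reasoning poset

  e⇒x≤x : ∀ x → (e ⇒ x) ≤ x
  e⇒x≤x x = begin
    e ⇒ x          ≡⟨ sym (identityˡ (e ⇒ x)) ⟩
    e · (e ⇒ x)    ≤⟨ ⇒-resid e x ⟩
    x              ∎

  ⇒-compat-≤ : ∀ {a a' b b' k l} → Q k → Q l → (a' · k) ≤ a → (b · l) ≤ b'
             → ((a ⇒ b) · (k · l)) ≤ (a' ⇒ b')
  ⇒-compat-≤ {a} {a'} {b} {b'} {k} {l} qk ql a'k≤a bl≤b' =
    ⇒-max a' b' _ (Q-· (⇒-in-Q a b) (Q-· qk ql)) (begin
      a' · ((a ⇒ b) · (k · l))    ≡⟨ sym (assoc a' (a ⇒ b) (k · l)) ⟩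
      (a' · (a ⇒ b)) · (k · l)    ≡⟨ interchange a' (a ⇒ b) k l ⟩
      (a' · k) · ((a ⇒ b) · l)    ≡⟨ sym (assoc (a' · k) (a ⇒ b) l) ⟩
      ((a' · k) · (a ⇒ b)) · l    ≤⟨ ·-monoˡ-≤ l (·-monoˡ-≤ (a ⇒ b) a'k≤a) ⟩
      (a · (a ⇒ b)) · l           ≤⟨ ·-monoˡ-≤ l (⇒-resid a b) ⟩
      b · l                       ≤⟨ bl≤b' ⟩
      b'                          ∎)

  Close : Carrier → Carrier → Carrier → Set c
  Close k a b = (a · k) ≤ b × (b · k) ≤ a

  Close-antitone : ∀ {k l a b} → l ≤ k → Close k a b → Close l a b
  Close-antitone {a = a} {b} l≤k (ak≤b , bk≤a) =
    ≤-trans (·-monoʳ-≤ a l≤k) ak≤b , ≤-trans (·-monoʳ-≤ b l≤k) bk≤a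

  module _ {h : Level} (H : Carrier → Set h) where

    θ-isEquivalence : H e → (∀ {x y} → H x → H y → H (x · y)) → IsEquivalence (θ A H)
    θ-isEquivalence H-e H-· = record
      { refl  = λ {a} → e , H-e , reflexive (identityʳ a) , reflexive (identityʳ a)
      ; sym   = λ (k , hk , close) → k , hk , swap close
      ; trans = λ { {a} {b} {d} (k , hk , ak≤b , bk≤a) (l , hl , bl≤d , dl≤b) →
          k · l , H-· hk hl , ·-≤-chain ak≤b bl≤d ,
          (begin
            d · (k · l)    ≡⟨ cong (d ·_) (comm k l) ⟩
            d · (l · k)    ≤⟨ ·-≤-chain dl≤b bk≤a ⟩
            a              ∎) }
      }

    θ-common-witness : IsConvexSubalgebra A H → ∀ {a a' b b'} → θ A H a a' → θ A H b b'
                     → Σ Carrier λ k → H k × Q k × Close k a a' × Close k b b'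
    θ-common-witness cs (k , hk , close-a) (l , hl , close-b) =
      e ⇒ (k ∧ l) , H-⇒ H-e (H-∧ hk hl) , ⇒-in-Q e (k ∧ l) ,
      Close-antitone (≤-trans (e⇒x≤x (k ∧ l)) (x∧y≤x k l)) close-a ,
      Close-antitone (≤-trans (e⇒x≤x (k ∧ l)) (x∧y≤y k l)) close-b
      where open IsConvexSubalgebra cs

    θ-compatible : IsConvexSubalgebra A H → (_∘_ : Op₂ Carrier) (f : Carrier → Carrier)
                 → (∀ {k} → H k → H (f k))
                 → (∀ {k a a' b b'} → Q k → Close k a a' → Close k b b' → ((a ∘ b) · f k) ≤ (a' ∘ b'))
                 → _∘_ Preserves₂ θ A H ⟶ θ A H ⟶ θ A H
    θ-compatible cs _∘_ f H-f ∘-compat-≤ θaa' θbb'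
      with k , hk , qk , close-a , close-b ← θ-common-witness cs θaa' θbb' =
      f k , H-f hk , ∘-compat-≤ qk close-a close-b , ∘-compat-≤ qk (swap close-a) (swap close-b)

lemma3p6 : {c h : Level} (A : SrlMonoid c) (H : SrlMonoid.Carrier A → Set h)
    → IsConvexSubalgebra A H → IsCongruence A (θ A H)
lemma3p6 A H cs = record
  { isEquivalence = θ-isEquivalence H H-e H-·
  ; ∧-compat = θ-compatible H cs _∧_ id id
      λ _ (ak≤a' , _) (bk≤b' , _) → ∧-compat-≤ ak≤a' bk≤b'
  ; ∨-compat = θ-compatible H cs _∨_ id id
      λ _ (ak≤a' , _) (bk≤b' , _) → ∨-compat-≤ ak≤a' bk≤b'
  ; ·-compat = θ-compatible H cs _·_ (λ k → k · k) (λ hk → H-· hk hk)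
      λ _ (ak≤a' , _) (bk≤b' , _) → ·-compat-≤ ak≤a' bk≤b'
  ; ⇒-compat = θ-compatible H cs _⇒_ (λ k → k · k) (λ hk → H-· hk hk)
      λ qk (_ , a'k≤a) (bk≤b' , _) → ⇒-compat-≤ qk qk a'k≤a bk≤b'
  }
  where
  open SrlMonoid A
  open SrlMonoidProperties A
  open IsConvexSubalgebra cs
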